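{- For every $n\in\mathbb{N}$, the number of prefix normal words of length $n$ is equal to the number of prefix normal words of length $n+1$ ending in $0$.
   Context: Words are over $\{0,1\}$. For a word $w$, $|w|_1$ denotes the number of $1$s in $w$ and $\mathrm{pref}_k(w)$ its prefix of length $k$; a factor is a contiguous subword. A word $w$ is prefix normal if every factor $v$ of $w$ satisfies $|v|_1 \le |\mathrm{pref}_{|v|}(w)|_1$. -}

module Defs where

open import Data.Bool using (Bool; true; false)
open import Data.Nat using (ℕ; zero; suc; _≤_)
open import Data.List using (List; []; _∷_; _++_; length; take; filter; [_])
open import Data.List.Relation.Unary.Unique.Propositional using (Unique)
open import Data.List.Membership.Propositional using (_∈_)
open import Data.Product using (Σ; ∃; _×_; _,_)
open import Relation.Binary.PropositionalEquality using (_≡_)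

-- Binary words: true encodes the letter 1, false encodes the letter 0.
Word : Set
Word = List Bool

ones : Word → ℕ
ones [] = zero
ones (true ∷ w) = suc (ones w)
ones (false ∷ w) = ones w

pref : ℕ → Word → Word
pref = take

Factor : Word → Word → Set
Factor v w = ∃ λ u → ∃ λ x → w ≡ u ++ v ++ x

PrefixNormal : Word → Set
PrefixNormal w = ∀ v → Factor v w → ones v ≤ ones (pref (length v) w)

EndsIn0 : Word → Set
EndsIn0 w = ∃ λ u → w ≡ u ++ (false ∷ [])

-- "exactly k words satisfy P": there is a duplicate-free list of length k
-- whose members are exactly the words satisfying P.
HasCount : (Word → Set) → ℕ → Set
HasCount P k = Σ (List Word) λ ws → length ws ≡ k × Unique ws × (∀ w → (w ∈ ws → P w) × (P w → w ∈ ws))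

IsPN : ℕ → Word → Set
IsPN n w = length w ≡ n × PrefixNormal w

IsPNEnd0 : ℕ → Word → Set
IsPNEnd0 n w = length w ≡ n × PrefixNormal w × EndsIn0 w

{-# OPTIONS --safe #-}

-- Appending a 0 preserves prefix normality: a factor ending in the new 0 has
-- as many 1s as the factor without it, which is bounded by the prefix one
-- letter shorter. Conversely every prefix of a prefix normal word is prefix
-- normal. Hence w ↦ w0 is a bijection from the prefix normal words of length n
-- onto those of length n+1 ending in 0. To count constructively, note that
-- prefix normality is decidable (a word has finitely many factors), so the
-- prefix normal words of length n are a filter of the list of all 2ⁿ words.
module Submission where

open import Defs
open import Data.Bool using (Bool; true; false)
open import Data.Nat using (ℕ; zero; suc; _+_; _^_; _≤_; _≤?_; z≤n; s≤s)
open import Data.Nat.Properties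
  using (module ≤-Reasoning; ≤-reflexive; ≤-trans; m≤m+n; m≤n+m; n≤1+n; +-comm; +-identityʳ; suc-injective)
open import Data.List using (List; []; _∷_; _++_; _∷ʳ_; [_]; length; take; map; filter; _∷ʳ′_; initLast)
open import Data.List.Properties
  using (length-++; length-map; ++-assoc; ++-identityʳ; ∷-injectiveʳ; ∷ʳ-injective; ∷ʳ-injectiveˡ)
open import Data.List.Membership.Propositional using (_∈_)
open import Data.List.Membership.Propositional.Properties
  using (∈-map⁺; ∈-map⁻; ∈-++⁺ˡ; ∈-++⁺ʳ; ∈-++⁻; ∈-filter⁺; ∈-filter⁻)
open import Data.List.Relation.Unary.All as All using (All; all?)
open import Data.List.Relation.Unary.Any using (here; there)
open import Data.List.Relation.Unary.Unique.Propositional using (Unique)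
import Data.List.Relation.Unary.Unique.Propositional.Properties as Unique
import Data.List.Relation.Unary.AllPairs as AllPairs
open import Data.List.Relation.Binary.Disjoint.Propositional using (Disjoint)
open import Data.Product using (∃; _×_; _,_; proj₁; proj₂; map₁)
open import Data.Sum using (_⊎_; inj₁; inj₂)
open import Function using (_∘_)
open import Function.Definitions using (Injective)
open import Relation.Binary.PropositionalEquality using (_≡_; refl; sym; trans; cong; cong₂; subst; module ≡-Reasoning)
open import Relation.Nullary using (Dec)
open import Relation.Nullary.Decidable using (map′)
open import Relation.Unary using (Decidable; _≐_)

module _ {A : Set} where

  length-∷ʳ : (xs : List A) (x : A) → length (xs ∷ʳ x) ≡ suc (length xs)
  length-∷ʳ xs x = trans (length-++ xs) (+-comm (length xs) 1)

  take-++ˡ : ∀ {k} (xs ys : List A) → k ≤ length xs → take k (xs ++ ys) ≡ take k xs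
  take-++ˡ {zero}  xs       ys _         = refl
  take-++ˡ {suc k} (x ∷ xs) ys (s≤s k≤) = cong (x ∷_) (take-++ˡ xs ys k≤)

  splits : List A → List (List A × List A)
  splits []       = [ ([] , []) ]
  splits (x ∷ xs) = ([] , x ∷ xs) ∷ map (map₁ (x ∷_)) (splits xs)

  ∈-splits⁺ : (xs ys : List A) → (xs , ys) ∈ splits (xs ++ ys)
  ∈-splits⁺ []       []       = here refl
  ∈-splits⁺ []       (y ∷ ys) = here refl
  ∈-splits⁺ (x ∷ xs) ys       = there (∈-map⁺ (map₁ (x ∷_)) (∈-splits⁺ xs ys))

  ∈-splits⁻ : ∀ zs {xs ys : List A} → (xs , ys) ∈ splits zs → xs ++ ys ≡ zs
  ∈-splits⁻ []       (here refl) = refl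
  ∈-splits⁻ (z ∷ zs) (here refl) = refl
  ∈-splits⁻ (z ∷ zs) (there p∈) with ∈-map⁻ (map₁ (z ∷_)) p∈
  ... | _ , q∈ , refl = cong (z ∷_) (∈-splits⁻ zs q∈)

ones-++ : (u v : Word) → ones (u ++ v) ≡ ones u + ones v
ones-++ []          v = refl
ones-++ (true ∷ u)  v = cong suc (ones-++ u v)
ones-++ (false ∷ u) v = ones-++ u v

ones-∷ʳ-false : (v : Word) → ones (v ∷ʳ false) ≡ ones v
ones-∷ʳ-false v = trans (ones-++ v [ false ]) (+-identityʳ (ones v))

ones-take-mono : ∀ {k m} → k ≤ m → (w : Word) → ones (take k w) ≤ ones (take m w)
ones-take-mono z≤n       w           = z≤n
ones-take-mono (s≤s k≤m) []          = z≤n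
ones-take-mono (s≤s k≤m) (true ∷ w)  = s≤s (ones-take-mono k≤m w)
ones-take-mono (s≤s k≤m) (false ∷ w) = ones-take-mono k≤m w

factor-length : ∀ {v w} → Factor v w → length v ≤ length w
factor-length {v} (u , x , refl) = begin
  length v                         ≤⟨ m≤m+n (length v) (length x) ⟩
  length v + length x              ≡⟨ length-++ v ⟨
  length (v ++ x)                  ≤⟨ m≤n+m _ (length u) ⟩
  length u + length (v ++ x)       ≡⟨ length-++ u ⟨
  length (u ++ v ++ x)             ∎
  where open ≤-Reasoning

factor-++ʳ : ∀ {v w} (y : Word) → Factor v w → Factor v (w ++ y)
factor-++ʳ {v} y (u , x , refl) = u , x ++ y , (begin
  (u ++ v ++ x) ++ y  ≡⟨ ++-assoc u (v ++ x) y ⟩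
  u ++ (v ++ x) ++ y  ≡⟨ cong (u ++_) (++-assoc v x y) ⟩
  u ++ v ++ x ++ y    ∎)
  where open ≡-Reasoning

factor-∷ʳ : ∀ {v w} {c : Bool} → Factor v (w ∷ʳ c) →
            Factor v w ⊎ ∃ λ v′ → v ≡ v′ ∷ʳ c × Factor v′ w
factor-∷ʳ {v} {w} (u , x , eq) with initLast x
... | x′ ∷ʳ′ c′ = inj₁ (u , x′ , ∷ʳ-injectiveˡ w (u ++ v ++ x′) (trans eq (begin
  u ++ v ++ x′ ∷ʳ c′    ≡⟨ cong (u ++_) (++-assoc v x′ [ c′ ]) ⟨
  u ++ (v ++ x′) ∷ʳ c′  ≡⟨ ++-assoc u (v ++ x′) [ c′ ] ⟨
  (u ++ v ++ x′) ∷ʳ c′  ∎)))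
  where open ≡-Reasoning
... | [] with initLast v
...   | []        = inj₁ ([] , w , refl)
...   | v′ ∷ʳ′ c′ with ∷ʳ-injective w (u ++ v′) (trans eq (begin
  u ++ (v′ ∷ʳ c′) ++ []  ≡⟨ cong (u ++_) (++-identityʳ (v′ ∷ʳ c′)) ⟩
  u ++ v′ ∷ʳ c′          ≡⟨ ++-assoc u v′ [ c′ ] ⟨
  (u ++ v′) ∷ʳ c′        ∎))
  where open ≡-Reasoning
...     | w≡uv′ , refl = inj₂ (v′ , refl , u , [] , trans w≡uv′ (cong (u ++_) (sym (++-identityʳ v′))))

all-factors? : {P : Word → Set} → Decidable P → (w : Word) → Dec (∀ v → Factor v w → P v)
all-factors? {P} P? w =
  map′ to from (all? (λ (_ , s) → all? (λ (v , _) → P? v) (splits s)) (splits w))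
  where
  AllFactors : Set
  AllFactors = All (λ (_ , s) → All (λ (v , _) → P v) (splits s)) (splits w)

  to : AllFactors → ∀ v → Factor v w → P v
  to all v (u , x , w≡uvx) =
    All.lookup (All.lookup all (subst (λ z → (u , v ++ x) ∈ splits z) (sym w≡uvx) (∈-splits⁺ u (v ++ x))))
               (∈-splits⁺ v x)

  from : (∀ v → Factor v w → P v) → AllFactors
  from h = All.tabulate λ {(u , s)} us∈ → All.tabulate λ {(v , x)} vx∈ →
    h v (u , x , sym (trans (cong (u ++_) (∈-splits⁻ s vx∈)) (∈-splits⁻ w us∈)))

prefixNormal? : Decidable PrefixNormal
prefixNormal? w = all-factors? (λ v → ones v ≤? ones (pref (length v) w)) w

prefixNormal-prefix : (w y : Word) → PrefixNormal (w ++ y) → PrefixNormal w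
prefixNormal-prefix w y pn v v⊑w =
  ≤-trans (pn v (factor-++ʳ y v⊑w)) (≤-reflexive (cong ones (take-++ˡ w y (factor-length v⊑w))))

prefixNormal-∷ʳ-false : ∀ {w} → PrefixNormal w → PrefixNormal (w ∷ʳ false)
prefixNormal-∷ʳ-false {w} pn v v⊑w0 with factor-∷ʳ v⊑w0
... | inj₁ v⊑w = begin
  ones v                                ≤⟨ pn v v⊑w ⟩
  ones (take (length v) w)              ≡⟨ cong ones (take-++ˡ w [ false ] (factor-length v⊑w)) ⟨
  ones (take (length v) (w ∷ʳ false))   ∎
  where open ≤-Reasoning
... | inj₂ (v′ , refl , v′⊑w) = begin
  ones (v′ ∷ʳ false)                                 ≡⟨ ones-∷ʳ-false v′ ⟩
  ones v′                                            ≤⟨ pn v′ v′⊑w ⟩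
  ones (take (length v′) w)                          ≡⟨ cong ones (take-++ˡ w [ false ] (factor-length v′⊑w)) ⟨
  ones (take (length v′) (w ∷ʳ false))               ≤⟨ ones-take-mono (n≤1+n _) (w ∷ʳ false) ⟩
  ones (take (suc (length v′)) (w ∷ʳ false))         ≡⟨ cong (λ k → ones (take k (w ∷ʳ false))) (length-∷ʳ v′ false) ⟨
  ones (take (length (v′ ∷ʳ false)) (w ∷ʳ false))    ∎
  where open ≤-Reasoning

isPNEnd0-suc≐ : ∀ n → (λ w → ∃ λ u → IsPN n u × w ≡ u ∷ʳ false) ≐ IsPNEnd0 (suc n)
isPNEnd0-suc≐ n = to , from
  where
  to : ∀ {w} → (∃ λ u → IsPN n u × w ≡ u ∷ʳ false) → IsPNEnd0 (suc n) w
  to (u , (refl , pn) , refl) = length-∷ʳ u false , prefixNormal-∷ʳ-false pn , u , refl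

  from : ∀ {w} → IsPNEnd0 (suc n) w → ∃ λ u → IsPN n u × w ≡ u ∷ʳ false
  from (|u0|≡1+n , pn , u , refl) =
    u , (suc-injective (trans (sym (length-∷ʳ u false)) |u0|≡1+n) , prefixNormal-prefix u [ false ] pn) , refl

words : ℕ → List Word
words zero    = [ [] ]
words (suc n) = map (true ∷_) (words n) ++ map (false ∷_) (words n)

length-words : ∀ n → length (words n) ≡ 2 ^ n
length-words zero    = refl
length-words (suc n) = begin
  length (map (true ∷_) ws ++ map (false ∷_) ws)         ≡⟨ length-++ (map (true ∷_) ws) ⟩
  length (map (true ∷_) ws) + length (map (false ∷_) ws) ≡⟨ cong₂ _+_ (length-map (true ∷_) ws) (length-map (false ∷_) ws) ⟩
  length ws + length ws                                  ≡⟨ cong (λ m → m + m) (length-words n) ⟩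
  2 ^ n + 2 ^ n                                          ≡⟨ cong (2 ^ n +_) (+-identityʳ (2 ^ n)) ⟨
  2 ^ suc n                                              ∎
  where
  ws = words n
  open ≡-Reasoning

∈-words⁺ : (w : Word) → w ∈ words (length w)
∈-words⁺ []          = here refl
∈-words⁺ (true ∷ w)  = ∈-++⁺ˡ (∈-map⁺ (true ∷_) (∈-words⁺ w))
∈-words⁺ (false ∷ w) = ∈-++⁺ʳ (map (true ∷_) (words (length w))) (∈-map⁺ (false ∷_) (∈-words⁺ w))

∈-words⁻ : ∀ n {w} → w ∈ words n → length w ≡ n
∈-words⁻ zero    (here refl) = refl
∈-words⁻ (suc n) w∈ with ∈-++⁻ (map (true ∷_) (words n)) w∈
... | inj₁ w∈₁ with ∈-map⁻ (true ∷_) w∈₁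
...   | u , u∈ , refl = cong suc (∈-words⁻ n u∈)
∈-words⁻ (suc n) w∈ | inj₂ w∈₂ with ∈-map⁻ (false ∷_) w∈₂
...   | u , u∈ , refl = cong suc (∈-words⁻ n u∈)

words-unique : ∀ n → Unique (words n)
words-unique zero    = All.[] AllPairs.∷ AllPairs.[]
words-unique (suc n) =
  Unique.++⁺ (Unique.map⁺ ∷-injectiveʳ (words-unique n)) (Unique.map⁺ ∷-injectiveʳ (words-unique n)) disjoint
  where
  disjoint : Disjoint (map (true ∷_) (words n)) (map (false ∷_) (words n))
  disjoint (w∈₁ , w∈₂) with ∈-map⁻ (true ∷_) w∈₁ | ∈-map⁻ (false ∷_) w∈₂
  ... | _ , _ , refl | _ , _ , ()

words-hasCount : ∀ n → HasCount (λ w → length w ≡ n) (2 ^ n)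
words-hasCount n = words n , length-words n , words-unique n , λ w → ∈-words⁻ n , λ { refl → ∈-words⁺ w }

hasCount-filter : ∀ {P Q : Word → Set} {k} → Decidable Q →
                  HasCount P k → ∃ λ k′ → HasCount (λ w → P w × Q w) k′
hasCount-filter {P} {Q} Q? (ws , _ , ws! , ws≐P) =
  length (filter Q? ws) , filter Q? ws , refl , Unique.filter⁺ Q? ws! , λ w → to , from
  where
  to : ∀ {w} → w ∈ filter Q? ws → P w × Q w
  to w∈ = let w∈ws , Qw = ∈-filter⁻ Q? w∈ in proj₁ (ws≐P _) w∈ws , Qw

  from : ∀ {w} → P w × Q w → w ∈ filter Q? ws
  from (Pw , Qw) = ∈-filter⁺ Q? (proj₂ (ws≐P _) Pw) Qw

hasCount-map : ∀ {P : Word → Set} {k} (f : Word → Word) → Injective _≡_ _≡_ f →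
               HasCount P k → HasCount (λ y → ∃ λ x → P x × y ≡ f x) k
hasCount-map {P} f f-inj (ws , |ws|≡k , ws! , ws≐P) =
  map f ws , trans (length-map f ws) |ws|≡k , Unique.map⁺ f-inj ws! , λ y → to , from
  where
  to : ∀ {y} → y ∈ map f ws → ∃ λ x → P x × y ≡ f x
  to y∈ = let x , x∈ws , y≡fx = ∈-map⁻ f y∈ in x , proj₁ (ws≐P x) x∈ws , y≡fx

  from : ∀ {y} → (∃ λ x → P x × y ≡ f x) → y ∈ map f ws
  from (x , Px , refl) = ∈-map⁺ f (proj₂ (ws≐P x) Px)

hasCount-cong : ∀ {P Q : Word → Set} {k} → P ≐ Q → HasCount P k → HasCount Q k
hasCount-cong (P⊆Q , Q⊆P) (ws , |ws|≡k , ws! , ws≐P) =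
  ws , |ws|≡k , ws! , λ w → P⊆Q ∘ proj₁ (ws≐P w) , proj₂ (ws≐P w) ∘ Q⊆P

mainTheorem6 : (n : ℕ) → ∃ λ k → HasCount (IsPN n) k × HasCount (IsPNEnd0 (suc n)) k
mainTheorem6 n =
  let k , pn = hasCount-filter prefixNormal? (words-hasCount n)
  in  k , pn , hasCount-cong (isPNEnd0-suc≐ n) (hasCount-map (_∷ʳ false) (∷ʳ-injectiveˡ _ _) pn)
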